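{- Let $B$ be an integral base-polyhedron in $\mathbb{R}^S$, $|S|=n$, and let $k$ be an integer with $1\le k\le n$. Then every decreasingly minimal element $m$ of $B\cap\mathbb{Z}^S$ minimizes the sum of its $k$ largest components over $B\cap\mathbb{Z}^S$, i.e. the sum of the $k$ largest components of $m$ is at most the sum of the $k$ largest components of any $y\in B\cap\mathbb{Z}^S$.
   Context: $S$ is a finite non-empty set. An integral base-polyhedron is $B=B'(p)=\{x\in\mathbb{R}^S:\widetilde x(S)=p(S),\ \widetilde x(Z)\ge p(Z)\ \forall Z\subset S\}$, where $\widetilde x(Z)=\sum_{s\in Z}x(s)$ and $p$ is a set-function on $S$ with values in $\mathbb{Z}\cup\{ -\infty\}$, $p(\emptyset)=0$, $p(S)$ finite, supermodular ($p(X)+p(Y)\le p(X\cap Y)+p(X\cup Y)$ whenever $p(X),p(Y)$ finite). For $x\in\mathbb{R}^S$, $x{\downarrow}$ denotes the components of $x$ in decreasing order; $x\le_{\rm dec}y$ if $x{\downarrow}=y{\downarrow}$ or $x{\downarrow}(j)<y{\downarrow}(j)$ at the first index $j$ where they differ. $m\in B\cap\mathbb{Z}^S$ is decreasingly minimal if $m\le_{\rm dec}y$ for every $y\in B\cap\mathbb{Z}^S$. -}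

module Defs where

open import Data.Nat using (ℕ; suc; _<_)
open import Data.Integer as ℤ using (ℤ; _≤_; 0ℤ)
import Data.Integer.Properties as ℤP
open import Data.Fin using (Fin)
open import Data.Fin.Subset using (Subset; _∩_; _∪_; ⊤; ⊥; _∈_; _⊂_)
open import Data.Fin.Subset.Properties using (_∈?_)
open import Data.List using (List; reverse; take; length; lookup; allFin; map)
open import Data.List.Base using (foldr)
open import Data.Maybe using (Maybe; just; nothing)
open import Data.Product using (Σ; ∃; _×_; _,_)
open import Data.Sum using (_⊎_)
open import Relation.Binary.PropositionalEquality using (_≡_)
open import Relation.Nullary.Decidable using (does)
open import Data.Bool using (if_then_else_)
import Data.List.Sort

-- Ground set S = Fin n.  A set function with values in ℤ ∪ {-∞}:
-- nothing represents -∞, just v a finite integer value v.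
SetFn : ℕ → Set
SetFn n = Subset n → Maybe ℤ

Σℤ : List ℤ → ℤ
Σℤ = foldr ℤ._+_ 0ℤ

x̃ : ∀ {n} → (Fin n → ℤ) → Subset n → ℤ
x̃ {n} x Z = Σℤ (map (λ s → if does (s ∈? Z) then x s else 0ℤ) (allFin n))

-- p(X) + p(Y) ≤ p(X ∩ Y) + p(X ∪ Y) whenever p(X), p(Y) finite
-- (with the convention that the right side is -∞ if one of its terms is).
Supermodular : ∀ {n} → SetFn n → Set
Supermodular {n} p = ∀ (X Y : Subset n) (a b : ℤ) → p X ≡ just a → p Y ≡ just b →
  Σ ℤ λ c → Σ ℤ λ d → p (X ∩ Y) ≡ just c × p (X ∪ Y) ≡ just d × (a ℤ.+ b) ≤ (c ℤ.+ d)

record IsBasePolyFn {n} (p : SetFn n) : Set where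
  field
    p-empty : p ⊥ ≡ just 0ℤ
    p-full-finite : Σ ℤ λ v → p ⊤ ≡ just v
    p-supermodular : Supermodular p

InBase : ∀ {n} → SetFn n → (Fin n → ℤ) → Set
InBase {n} p x = p ⊤ ≡ just (x̃ x ⊤) × (∀ (Z : Subset n) → Z ⊂ ⊤ → ∀ v → p Z ≡ just v → v ≤ x̃ x Z)

open Data.List.Sort ℤP.≤-decTotalOrder using (sort)

_↓ : ∀ {n} → (Fin n → ℤ) → List ℤ
_↓ {n} x = reverse (sort (map x (allFin n)))

_≤dec_ : ∀ {n} → (Fin n → ℤ) → (Fin n → ℤ) → Set
x ≤dec y = (x ↓ ≡ y ↓) ⊎
  (Σ ℕ λ j → Σ (j < length (x ↓)) λ jx → Σ (j < length (y ↓)) λ jy →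
     (∀ i (ix : i < length (x ↓)) (iy : i < length (y ↓)) → i < j →
        lookup (x ↓) (Data.Fin.fromℕ< ix) ≡ lookup (y ↓) (Data.Fin.fromℕ< iy))
     × (lookup (x ↓) (Data.Fin.fromℕ< jx) ℤ.< lookup (y ↓) (Data.Fin.fromℕ< jy)))

DecMin : ∀ {n} → SetFn n → (Fin n → ℤ) → Set
DecMin {n} p m = InBase p m × (∀ (y : Fin n → ℤ) → InBase p y → m ≤dec y)

topSum : ∀ {n} → ℕ → (Fin n → ℤ) → ℤ
topSum k x = Σℤ (take k (x ↓))

-- Induction on the ℓ₁-distance from y to m.  If y ≠ m, let t maximise y among the
-- components where y exceeds m.  The exchange property of base polyhedra yields s with
-- y s < m s such that y − χ_t + χ_s stays in B; it is closer to m.  Moreover y s < y t: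
-- decreasing minimality forbids m − χ_s + χ_u ∈ B whenever m u + 1 < m s, and the tight
-- sets witnessing this intersect (by supermodularity) to an m-tight set Z ∋ s.  If y t ≤ y s
-- then y ≤ m on Z, so y(Z) < m(Z) = p(Z), contradicting y ∈ B.  Finally, moving a unit from
-- a larger to a smaller component never increases the sum of the k largest components.

module Submission where

open import Defs

open import Algebra.Bundles using (CommutativeMonoid)
open import Data.Bool using (Bool; true; false; if_then_else_; _∧_; _∨_)
open import Data.Empty using (⊥-elim)
open import Data.Fin as Fin using (Fin; punchIn; punchOut; fromℕ<)
open import Data.Fin.Properties as FinP using (any?)
open import Data.Fin.Subset using (Subset; _∩_; _∪_; ⊤; _∈_; _∉_; _⊂_)
open import Data.Fin.Subset.Properties
  using (_∈?_; ∈⊤; ⊆⊤; ⊆-antisym; anySubset?; x∈p∩q⁺; x∈p∩q⁻)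
open import Data.Integer as ℤ using (ℤ; _+_; _-_; _*_; 0ℤ; 1ℤ; -1ℤ; ∣_∣; _≤_; _<_; _≥_)
import Data.Integer.Properties as ℤP
open import Data.Integer.Tactic.RingSolver using (solve-∀)
open import Data.List
  using (List; []; _∷_; _++_; take; map; reverse; tabulate; allFin; filter; length; lookup)
import Data.List.Properties as ListP
open import Data.List.Extrema ℤP.≤-totalOrder using (argmax; argmax-all; v≤f[argmax]⁺)
open import Data.List.Membership.Propositional using (lose) renaming (_∈_ to _∈ₗ_)
open import Data.List.Membership.Propositional.Properties
  using (∈-∃++; ∈-++⁻; ∈-++⁺ʳ; ∈-tabulate⁻; ∈-filter⁺; ∈-allFin)
open import Data.List.Relation.Binary.Permutation.Propositional
  using ( _↭_; ↭-refl; ↭-sym; ↭-trans; ↭-reflexive; prep; swap; ↭⇒↭ₛ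
        ; module PermutationReasoning)
open import Data.List.Relation.Binary.Permutation.Propositional.Properties
  using (↭-empty-inv; ∈-resp-↭; drop-mid; shift; ↭-reverse; map⁺)
open import Data.List.Relation.Binary.Permutation.Setoid.Properties using (foldr-commMonoid)
open import Data.List.Relation.Unary.All as All using (All; []; _∷_)
open import Data.List.Relation.Unary.All.Properties using (all-filter)
open import Data.List.Relation.Unary.AllPairs using (AllPairs; []; _∷_)
import Data.List.Relation.Unary.AllPairs.Properties as AllPairsP
open import Data.List.Relation.Unary.Any using (here; there)
import Data.List.Relation.Unary.Any.Properties as AnyP
open import Data.List.Relation.Unary.Sorted.TotalOrder.Properties using (Sorted⇒AllPairs)
open import Data.List.Sort ℤP.≤-decTotalOrder using (sort; sort-↭; sort-↗)
open import Data.Maybe using (just)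
import Data.Maybe.Properties as MaybeP
open import Data.Nat as ℕ using (ℕ; zero; suc; s≤s)
open import Data.Nat.ListAction using (sum)
open import Data.Nat.ListAction.Properties using (sum-↭)
import Data.Nat.Properties as ℕP
open import Data.Product using (∃; ∃₂; _×_; _,_; proj₁; proj₂)
open import Data.Sum using (inj₁; inj₂)
import Data.Vec as Vec
import Data.Vec.Properties as VecP
open import Function using (_∘_; id; flip)
open import Relation.Binary.PropositionalEquality
  using (_≡_; _≢_; refl; sym; trans; cong; cong₂; subst; subst₂; module ≡-Reasoning)
open import Relation.Nullary using (¬_; Dec; yes; no; does; contradiction)
open import Relation.Nullary.Decidable using (¬?; _×-dec_; decidable-stable)
open import Relation.Unary using (Decidable)

i-1+1≡i : ∀ i → i - 1ℤ + 1ℤ ≡ i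
i-1+1≡i = solve-∀

i+1-1≡i : ∀ i → i + 1ℤ - 1ℤ ≡ i
i+1-1≡i = solve-∀

+-cancelʳ-≤ : ∀ {i j} k → i + k ≤ j + k → i ≤ j
+-cancelʳ-≤ {i} {j} k i+k≤j+k =
  subst₂ _≤_ (lemma i k) (lemma j k) (ℤP.+-monoˡ-≤ (ℤ.- k) i+k≤j+k)
  where lemma : ∀ i k → i + k - k ≡ i
        lemma = solve-∀

i<j⇒0<j-i : ∀ {i j} → i < j → 0ℤ < j - i
i<j⇒0<j-i {i} {j} i<j = subst (_< j - i) (ℤP.+-inverseʳ i) (ℤP.+-monoˡ-< (ℤ.- i) i<j)

i<j⇒i≤j-1 : ∀ {i j} → i < j → i ≤ j - 1ℤ
i<j⇒i≤j-1 {j = j} i<j = subst (_ ≤_) (ℤP.+-comm -1ℤ j) (ℤP.i<j⇒i≤pred[j] i<j)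

i+1<j⇒i<j : ∀ {i j} → i + 1ℤ < j → i < j
i+1<j⇒i<j {i} = ℤP.≤-<-trans (ℤP.i≤i+j i 1ℤ)

i<j⇒i+1≤j : ∀ {i j} → i < j → i + 1ℤ ≤ j
i<j⇒i+1≤j {i} i<j = subst (_≤ _) (ℤP.+-comm 1ℤ i) (ℤP.i<j⇒suc[i]≤j i<j)

∣i-j∣≡1+∣i-[j+1]∣ : ∀ {i j} → j < i → ∣ i - j ∣ ≡ suc ∣ i - (j + 1ℤ) ∣
∣i-j∣≡1+∣i-[j+1]∣ {i} {j} j<i =
  trans (cong ∣_∣ (lemma i j)) (∣k+1∣ (ℤP.i≤j⇒0≤j-i (i<j⇒i+1≤j j<i)))
  where
  lemma : ∀ i j → i - j ≡ i - (j + 1ℤ) + 1ℤ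
  lemma = solve-∀
  ∣k+1∣ : ∀ {k} → 0ℤ ≤ k → ∣ k + 1ℤ ∣ ≡ suc ∣ k ∣
  ∣k+1∣ {ℤ.+ n} _ = ℕP.+-comm n 1

All-reverse : ∀ {A : Set} {P : A → Set} {xs} → All P xs → All P (reverse xs)
All-reverse pxs = All.tabulate (λ x∈ → All.lookup pxs (AnyP.reverse⁻ x∈))

AllPairs-reverse : ∀ {A : Set} {R : A → A → Set} {xs} →
  AllPairs R xs → AllPairs (flip R) (reverse xs)
AllPairs-reverse {xs = []} [] = []
AllPairs-reverse {R = R} {xs = x ∷ xs} (Rx ∷ Rxs) =
  subst (AllPairs (flip R)) (sym (ListP.unfold-reverse x xs))
    (AllPairsP.++⁺ (AllPairs-reverse Rxs) ([] ∷ []) (All.map (_∷ []) (All-reverse Rx)))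

↭-pull-two : ∀ {A : Set} {a b : A} P Q T → P ++ a ∷ Q ++ b ∷ T ↭ a ∷ b ∷ P ++ Q ++ T
↭-pull-two {a = a} {b} P Q T = begin
  P ++ a ∷ Q ++ b ∷ T    ↭⟨ shift a P (Q ++ b ∷ T) ⟩
  a ∷ P ++ Q ++ b ∷ T    ≡⟨ cong (a ∷_) (sym (ListP.++-assoc P Q (b ∷ T))) ⟩
  a ∷ (P ++ Q) ++ b ∷ T  ↭⟨ prep a (shift b (P ++ Q) T) ⟩
  a ∷ b ∷ (P ++ Q) ++ T  ≡⟨ cong (λ xs → a ∷ b ∷ xs) (ListP.++-assoc P Q T) ⟩
  a ∷ b ∷ P ++ Q ++ T    ∎
  where open PermutationReasoning

Σℤ-↭ : ∀ {xs ys} → xs ↭ ys → Σℤ xs ≡ Σℤ ys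
Σℤ-↭ xs↭ys = foldr-commMonoid setoid isCommutativeMonoid (↭⇒↭ₛ xs↭ys)
  where open CommutativeMonoid ℤP.+-0-commutativeMonoid

-- Prefix sums of descending lists

prefixSum : ℕ → List ℤ → ℤ
prefixSum k xs = Σℤ (take k xs)

Descending : List ℤ → Set
Descending = AllPairs _≥_

prefixSum-raise : ∀ {b d} → 0ℤ ≤ d → ∀ j Q T →
  prefixSum j (Q ++ b + d ∷ T) ≤ prefixSum j (Q ++ b ∷ T) + d
prefixSum-raise     {d = d} 0≤d zero    Q       T = ℤP.≤-trans 0≤d (ℤP.≤-reflexive (sym (ℤP.+-identityˡ d)))
prefixSum-raise {b} {d}     _   (suc j) []      T = ℤP.≤-reflexive (lemma b d (prefixSum j T))
  where lemma : ∀ b d s → b + d + s ≡ b + s + d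
        lemma = solve-∀
prefixSum-raise     {d = d} 0≤d (suc j) (q ∷ Q) T =
  ℤP.≤-trans (ℤP.+-monoʳ-≤ q (prefixSum-raise 0≤d j Q T))
             (ℤP.≤-reflexive (sym (ℤP.+-assoc q _ d)))

prefixSum-shift-forward : ∀ {a b d} → 0ℤ ≤ d → ∀ k P Q T →
  prefixSum k (P ++ a ∷ Q ++ b + d ∷ T) ≤ prefixSum k (P ++ a + d ∷ Q ++ b ∷ T)
prefixSum-shift-forward 0≤d zero    P       Q T = ℤP.≤-refl
prefixSum-shift-forward 0≤d (suc k) (x ∷ P) Q T =
  ℤP.+-monoʳ-≤ x (prefixSum-shift-forward 0≤d k P Q T)
prefixSum-shift-forward {a} {b} {d} 0≤d (suc k) [] Q T =
  ℤP.≤-trans (ℤP.+-monoʳ-≤ a (prefixSum-raise 0≤d k Q T))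
             (ℤP.≤-reflexive (lemma a d (prefixSum k (Q ++ b ∷ T))))
  where lemma : ∀ a d s → a + (s + d) ≡ a + d + s
        lemma = solve-∀

prefixSum-≤-descending : ∀ {ws zs} → Descending ws → zs ↭ ws →
  ∀ k → prefixSum k zs ≤ prefixSum k ws
prefixSum-≤-descending {[]} _ zs↭[] k rewrite ↭-empty-inv zs↭[] = ℤP.≤-refl
prefixSum-≤-descending {w ∷ ws} {zs} (w≥ws ∷ desc) zs↭ k
  with A , B , refl ← ∈-∃++ (∈-resp-↭ (↭-sym zs↭) (here refl))
  = insert A B (drop-mid A [] zs↭) k
  where
  insert : ∀ A B → A ++ B ↭ ws → ∀ k → prefixSum k (A ++ w ∷ B) ≤ prefixSum k (w ∷ ws)
  insert A B _ zero = ℤP.≤-refl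
  insert [] B B↭ws (suc k) = ℤP.+-monoʳ-≤ w (prefixSum-≤-descending desc B↭ws k)
  -- Exchanging w with the entry c ≤ w at the front is a forward shift of w − c.
  insert (c ∷ A) B cAB↭ws (suc k) = begin
    prefixSum (suc k) (c ∷ A ++ w ∷ B)
      ≡⟨ cong (λ v → prefixSum (suc k) (c ∷ A ++ v ∷ B)) w≡c+d ⟩
    prefixSum (suc k) (c ∷ A ++ c + d ∷ B)
      ≤⟨ prefixSum-shift-forward {c} {c} (ℤP.i≤j⇒0≤j-i c≤w) (suc k) [] A B ⟩
    c + d + prefixSum k (A ++ c ∷ B)
      ≡⟨ cong (_+ prefixSum k (A ++ c ∷ B)) (sym w≡c+d) ⟩
    w + prefixSum k (A ++ c ∷ B)
      ≤⟨ ℤP.+-monoʳ-≤ w (prefixSum-≤-descending desc AcB↭ws k) ⟩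
    w + prefixSum k ws ∎
    where
    open ℤP.≤-Reasoning
    c≤w : c ≤ w
    c≤w = All.lookup w≥ws (∈-resp-↭ cAB↭ws (here refl))
    d = w - c
    w≡c+d : w ≡ c + d
    w≡c+d = lemma w c
      where lemma : ∀ w c → w ≡ c + (w - c)
            lemma = solve-∀
    AcB↭ws : A ++ c ∷ B ↭ ws
    AcB↭ws = ↭-trans (shift c A B) cAB↭ws

descending-≤-earlier : ∀ {a b} P X → Descending (P ++ b ∷ X) → a ∈ₗ X → a ≤ b
descending-≤-earlier []      X (b≥X ∷ _) a∈X = All.lookup b≥X a∈X
descending-≤-earlier (_ ∷ P) X (_ ∷ desc) a∈X = descending-≤-earlier P X desc a∈X

descending-split : ∀ {a b R ws} → Descending ws → ws ↭ a ∷ b ∷ R → b ≤ a →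
  ∃₂ λ P Q → ∃ λ T → ws ≡ P ++ a ∷ Q ++ b ∷ T × P ++ Q ++ T ↭ R
descending-split {a} {b} {R} desc ws↭ b≤a
  with P , Q′ , refl ← ∈-∃++ (∈-resp-↭ (↭-sym ws↭) (here refl))
  with PQ′↭ ← drop-mid P [] ws↭
  with ∈-++⁻ P (∈-resp-↭ (↭-sym PQ′↭) (here refl))
... | inj₂ b∈Q′ with Q , T , refl ← ∈-∃++ b∈Q′ =
  P , Q , T , refl ,
  subst (_↭ R) (ListP.++-assoc P Q T)
        (drop-mid (P ++ Q) [] (subst (_↭ b ∷ R) (sym (ListP.++-assoc P Q (b ∷ T))) PQ′↭))
-- If b occurs before a then a ≡ b, and the two occurrences exchange roles.
... | inj₁ b∈P with P₁ , P₂ , refl ← ∈-∃++ b∈P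
  with refl ← ℤP.≤-antisym b≤a
    (descending-≤-earlier P₁ (P₂ ++ a ∷ Q′)
       (subst Descending (ListP.++-assoc P₁ (b ∷ P₂) (a ∷ Q′)) desc) (∈-++⁺ʳ P₂ (here refl))) =
  P₁ , P₂ , Q′ , ListP.++-assoc P₁ (a ∷ P₂) (a ∷ Q′) ,
  drop-mid P₁ [] (subst (_↭ a ∷ R) (ListP.++-assoc P₁ (a ∷ P₂) Q′) PQ′↭)

prefixSum-transfer : ∀ {p q R ws ws′} → q < p → Descending ws → Descending ws′ →
  ws ↭ p ∷ q ∷ R → ws′ ↭ p - 1ℤ ∷ q + 1ℤ ∷ R →
  ∀ k → prefixSum k ws′ ≤ prefixSum k ws
prefixSum-transfer {p} {q} {R} {ws} {ws′} q<p desc desc′ ws↭ ws′↭ k with q + 1ℤ ℤP.<? p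
... | no q+1≮p = prefixSum-≤-descending desc ws′↭ws k
  where
  q+1≡p : q + 1ℤ ≡ p
  q+1≡p = ℤP.≤-antisym (i<j⇒i+1≤j q<p) (ℤP.≮⇒≥ q+1≮p)
  p-1≡q : p - 1ℤ ≡ q
  p-1≡q = trans (cong (_- 1ℤ) (sym q+1≡p)) (i+1-1≡i q)
  ws′↭ws : ws′ ↭ ws
  ws′↭ws = ↭-trans ws′↭ (↭-trans (↭-reflexive (cong₂ (λ u v → u ∷ v ∷ R) p-1≡q q+1≡p))
                                  (↭-trans (swap q p ↭-refl) (↭-sym ws↭)))
-- Here p − 1 precedes q + 1 in the sorted ws′, and undoing the transfer in place is a forward shift.
... | yes q+1<p
  with P , Q , T , refl , PQT↭R ← descending-split desc′ ws′↭ (i<j⇒i≤j-1 q+1<p) = begin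
    prefixSum k (P ++ p - 1ℤ ∷ Q ++ q + 1ℤ ∷ T)
      ≤⟨ prefixSum-shift-forward (ℤ.+≤+ ℕ.z≤n) k P Q T ⟩
    prefixSum k (P ++ p - 1ℤ + 1ℤ ∷ Q ++ q ∷ T)
      ≡⟨ cong (λ v → prefixSum k (P ++ v ∷ Q ++ q ∷ T)) (i-1+1≡i p) ⟩
    prefixSum k (P ++ p ∷ Q ++ q ∷ T)
      ≤⟨ prefixSum-≤-descending desc PpQqT↭ws k ⟩
    prefixSum k ws ∎
  where
  open ℤP.≤-Reasoning
  PpQqT↭ws : P ++ p ∷ Q ++ q ∷ T ↭ ws
  PpQqT↭ws = ↭-trans (↭-pull-two P Q T) (↭-trans (prep p (prep q PQT↭R)) (↭-sym ws↭))

prefixSum-<-lex : ∀ j xs ys (jx : j ℕ.< length xs) (jy : j ℕ.< length ys) →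
  (∀ i (ix : i ℕ.< length xs) (iy : i ℕ.< length ys) → i ℕ.< j →
     lookup xs (fromℕ< ix) ≡ lookup ys (fromℕ< iy)) →
  lookup xs (fromℕ< jx) < lookup ys (fromℕ< jy) → prefixSum (suc j) xs < prefixSum (suc j) ys
prefixSum-<-lex zero    (x ∷ xs) (y ∷ ys) _ _ _ x<y = ℤP.+-monoˡ-< 0ℤ x<y
prefixSum-<-lex (suc j) (x ∷ xs) (y ∷ ys) (s≤s jx) (s≤s jy) agree lt
  rewrite agree 0 (s≤s ℕ.z≤n) (s≤s ℕ.z≤n) (s≤s ℕ.z≤n) =
  ℤP.+-monoʳ-< y (prefixSum-<-lex j xs ys jx jy
    (λ i ix iy i<j → agree (suc i) (s≤s ix) (s≤s iy) (s≤s i<j)) lt)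

-- Moving one unit between two coordinates

transfer : ∀ {n} → Fin n → Fin n → (Fin n → ℤ) → Fin n → ℤ
transfer t s x u with u Fin.≟ t | u Fin.≟ s
... | yes _ | _     = x u - 1ℤ
... | no _  | yes _ = x u + 1ℤ
... | no _  | no _  = x u

transfer-source : ∀ {n} (t s : Fin n) x → transfer t s x t ≡ x t - 1ℤ
transfer-source t s x with t Fin.≟ t
... | yes _  = refl
... | no t≢t = ⊥-elim (t≢t refl)

transfer-target : ∀ {n} {t s : Fin n} x → t ≢ s → transfer t s x s ≡ x s + 1ℤ
transfer-target {t = t} {s} x t≢s with s Fin.≟ t | s Fin.≟ s
... | yes s≡t | _     = ⊥-elim (t≢s (sym s≡t))
... | no _    | yes _ = refl
... | no _    | no s≢s = ⊥-elim (s≢s refl)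

transfer-other : ∀ {n} {t s u : Fin n} x → u ≢ t → u ≢ s → transfer t s x u ≡ x u
transfer-other {t = t} {s} {u} x u≢t u≢s with u Fin.≟ t | u Fin.≟ s
... | yes u≡t | _       = ⊥-elim (u≢t u≡t)
... | no _    | yes u≡s = ⊥-elim (u≢s u≡s)
... | no _    | no _    = refl

distinct-by-< : ∀ {n} {x : Fin n → ℤ} {t s} → x s < x t → t ≢ s
distinct-by-< xs<xt refl = ℤP.<-irrefl refl xs<xt

tabulate-↭-punchIn : ∀ {A : Set} {n} (t : Fin (suc n)) (f : Fin (suc n) → A) →
  tabulate f ↭ f t ∷ tabulate (f ∘ punchIn t)
tabulate-↭-punchIn Fin.zero f = ↭-refl
tabulate-↭-punchIn {n = suc n} (Fin.suc t) f =
  ↭-trans (prep (f Fin.zero) (tabulate-↭-punchIn t (f ∘ Fin.suc)))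
          (swap (f Fin.zero) (f (Fin.suc t)) ↭-refl)

tabulate-↭-punchIn₂ : ∀ {A : Set} {n} (t : Fin (suc (suc n))) s (f : Fin (suc (suc n)) → A) →
  tabulate f ↭ f t ∷ f (punchIn t s) ∷ map f (tabulate (punchIn t ∘ punchIn s))
tabulate-↭-punchIn₂ t s f = begin
  tabulate f                                             ↭⟨ tabulate-↭-punchIn t f ⟩
  f t ∷ tabulate (f ∘ punchIn t)                         ↭⟨ prep (f t) (tabulate-↭-punchIn s (f ∘ punchIn t)) ⟩
  f t ∷ f (punchIn t s) ∷ tabulate (f ∘ punchIn t ∘ punchIn s)
    ≡⟨ cong (λ xs → f t ∷ f (punchIn t s) ∷ xs) (ListP.map-tabulate (punchIn t ∘ punchIn s) f) ⟨
  f t ∷ f (punchIn t s) ∷ map f (tabulate (punchIn t ∘ punchIn s)) ∎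
  where open PermutationReasoning

punchIn₂-distinct : ∀ {n} {t : Fin (suc (suc n))} {s u} → u ∈ₗ tabulate (punchIn t ∘ punchIn s) →
  u ≢ t × u ≢ punchIn t s
punchIn₂-distinct {t = t} {s} u∈ with i , refl ← ∈-tabulate⁻ u∈ =
  FinP.punchInᵢ≢i t (punchIn s i) , FinP.punchInᵢ≢i s i ∘ FinP.punchIn-injective t _ _

tabulate-↭-pair : ∀ {n} {t s : Fin n} → t ≢ s → ∃ λ R → All (λ u → u ≢ t × u ≢ s) R ×
  (∀ {A : Set} (f : Fin n → A) → tabulate f ↭ f t ∷ f s ∷ map f R)
tabulate-↭-pair {suc zero} {Fin.zero} {Fin.zero} t≢t = ⊥-elim (t≢t refl)
tabulate-↭-pair {suc (suc n)} {t} {s} t≢s = split (punchOut t≢s) (FinP.punchIn-punchOut t≢s)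
  where
  split : ∀ s′ → punchIn t s′ ≡ s → ∃ λ R → All (λ u → u ≢ t × u ≢ s) R ×
    (∀ {A : Set} (f : Fin (suc (suc n)) → A) → tabulate f ↭ f t ∷ f s ∷ map f R)
  split s′ refl =
    tabulate (punchIn t ∘ punchIn s′) , All.tabulate punchIn₂-distinct , tabulate-↭-punchIn₂ t s′

tabulate-transfer : ∀ {n} {t s : Fin n} → t ≢ s → ∃ λ R → ∀ {A : Set} (F : Fin n → ℤ → A) x →
  tabulate (λ u → F u (x u)) ↭ F t (x t) ∷ F s (x s) ∷ map (λ u → F u (x u)) R ×
  tabulate (λ u → F u (transfer t s x u)) ↭ F t (x t - 1ℤ) ∷ F s (x s + 1ℤ) ∷ map (λ u → F u (x u)) R
tabulate-transfer {t = t} {s} t≢s with R , distinct , split ← tabulate-↭-pair t≢s =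
  R , λ F x → split (λ u → F u (x u)) ,
    ↭-trans (split (λ u → F u (transfer t s x u)))
      (↭-reflexive (cong₂ _∷_
        (cong (F t) (transfer-source t s x))
        (cong₂ _∷_ (cong (F s) (transfer-target x t≢s))
          (ListP.map-cong-local
            (All.map (λ (u≢t , u≢s) → cong (F _) (transfer-other x u≢t u≢s)) distinct)))))

↓-↭ : ∀ {n} (x : Fin n → ℤ) → x ↓ ↭ tabulate x
↓-↭ x = ↭-trans (↭-reverse _) (↭-trans (sort-↭ _) (↭-reflexive (ListP.map-tabulate id x)))

↓-descending : ∀ {n} (x : Fin n → ℤ) → Descending (x ↓)
↓-descending x = AllPairs-reverse (Sorted⇒AllPairs ℤP.≤-totalOrder (sort-↗ _))

↓-cong : ∀ {n} {x y : Fin n → ℤ} → (∀ u → x u ≡ y u) → x ↓ ≡ y ↓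
↓-cong x≗y = cong (reverse ∘ sort) (ListP.map-cong x≗y (allFin _))

topSum-transfer : ∀ {n} {t s : Fin n} (x : Fin n → ℤ) → x s < x t →
  ∀ k → topSum k (transfer t s x) ≤ topSum k x
topSum-transfer {t = t} {s} x xs<xt with R , split ← tabulate-transfer (distinct-by-< {x = x} xs<xt)
  with before , after ← split (λ _ v → v) x =
  prefixSum-transfer xs<xt (↓-descending x) (↓-descending (transfer t s x))
    (↭-trans (↓-↭ x) before) (↭-trans (↓-↭ (transfer t s x)) after)

sumOfSquares : ∀ {n} → (Fin n → ℤ) → ℤ
sumOfSquares x = Σℤ (tabulate (λ u → x u * x u))

sumOfSquares-↓ : ∀ {n} {x y : Fin n → ℤ} → x ↓ ≡ y ↓ → sumOfSquares x ≡ sumOfSquares y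
sumOfSquares-↓ {x = x} {y} x↓≡y↓ = begin
  sumOfSquares x                  ≡⟨ cong Σℤ (ListP.map-tabulate x sq) ⟨
  Σℤ (map sq (tabulate x))        ≡⟨ Σℤ-↭ (map⁺ sq (↭-sym (↓-↭ x))) ⟩
  Σℤ (map sq (x ↓))               ≡⟨ cong (Σℤ ∘ map sq) x↓≡y↓ ⟩
  Σℤ (map sq (y ↓))               ≡⟨ Σℤ-↭ (map⁺ sq (↓-↭ y)) ⟩
  Σℤ (map sq (tabulate y))        ≡⟨ cong Σℤ (ListP.map-tabulate y sq) ⟩
  sumOfSquares y                  ∎
  where
  open ≡-Reasoning
  sq : ℤ → ℤ
  sq v = v * v

sumOfSquares-transfer : ∀ {n} {t s : Fin n} (x : Fin n → ℤ) → x s + 1ℤ < x t →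
  sumOfSquares (transfer t s x) < sumOfSquares x
sumOfSquares-transfer {t = t} {s} x xs+1<xt
  with R , split ← tabulate-transfer (distinct-by-< {x = x} (i+1<j⇒i<j xs+1<xt))
  with before , after ← split (λ _ v → v * v) x = begin-strict
  sumOfSquares (transfer t s x)  ≡⟨ Σℤ-↭ after ⟩
  S′                             ≡⟨ ℤP.+-identityʳ S′ ⟨
  S′ + 0ℤ                        <⟨ ℤP.+-monoʳ-< S′ (ℤP.+-mono-< 0<e 0<e) ⟩
  S′ + (e + e)                   ≡⟨ expand a b r ⟩
  a * a + (b * b + r)            ≡⟨ Σℤ-↭ before ⟨
  sumOfSquares x                 ∎
  where
  open ℤP.≤-Reasoning
  a = x t
  b = x s
  r = Σℤ (map (λ u → x u * x u) R)
  S′ = (a - 1ℤ) * (a - 1ℤ) + ((b + 1ℤ) * (b + 1ℤ) + r)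
  e = a - (b + 1ℤ)
  0<e : 0ℤ < e
  0<e = i<j⇒0<j-i xs+1<xt
  expand : ∀ a b r → (a - 1ℤ) * (a - 1ℤ) + ((b + 1ℤ) * (b + 1ℤ) + r) + (a - (b + 1ℤ) + (a - (b + 1ℤ)))
                   ≡ a * a + (b * b + r)
  expand = solve-∀

distance : ∀ {n} → (Fin n → ℤ) → (Fin n → ℤ) → ℕ
distance m y = sum (tabulate (λ u → ∣ y u - m u ∣))

distance-transfer : ∀ {n} {t s : Fin n} (m y : Fin n → ℤ) → m t < y t → y s < m s →
  distance m (transfer t s y) ℕ.< distance m y
distance-transfer {t = t} {s} m y mt<yt ys<ms
  with R , split ← tabulate-transfer (λ { refl → ℤP.<-asym mt<yt ys<ms })
  with before , after ← split (λ u v → ∣ v - m u ∣) y = begin-strict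
  distance m (transfer t s y)
    ≡⟨ sum-↭ after ⟩
  ∣ y t - 1ℤ - m t ∣ ℕ.+ (∣ y s + 1ℤ - m s ∣ ℕ.+ rest)
    <⟨ ℕP.+-mono-<-≤ (ℕP.n<1+n _) (ℕP.+-monoˡ-≤ rest (ℕP.n≤1+n _)) ⟩
  suc ∣ y t - 1ℤ - m t ∣ ℕ.+ (suc ∣ y s + 1ℤ - m s ∣ ℕ.+ rest)
    ≡⟨ cong₂ (λ a b → a ℕ.+ (b ℕ.+ rest)) at-t at-s ⟨
  ∣ y t - m t ∣ ℕ.+ (∣ y s - m s ∣ ℕ.+ rest)
    ≡⟨ sum-↭ before ⟨
  distance m y ∎
  where
  open ℕP.≤-Reasoning
  rest = sum (map (λ u → ∣ y u - m u ∣) R)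
  at-t : ∣ y t - m t ∣ ≡ suc ∣ y t - 1ℤ - m t ∣
  at-t = trans (∣i-j∣≡1+∣i-[j+1]∣ mt<yt) (cong (suc ∘ ∣_∣) (lemma (y t) (m t)))
    where lemma : ∀ a b → a - (b + 1ℤ) ≡ a - 1ℤ - b
          lemma = solve-∀
  at-s : ∣ y s - m s ∣ ≡ suc ∣ y s + 1ℤ - m s ∣
  at-s = begin-equality
    ∣ y s - m s ∣             ≡⟨ ℤP.∣i-j∣≡∣j-i∣ (y s) (m s) ⟩
    ∣ m s - y s ∣             ≡⟨ ∣i-j∣≡1+∣i-[j+1]∣ ys<ms ⟩
    suc ∣ m s - (y s + 1ℤ) ∣  ≡⟨ cong suc (ℤP.∣i-j∣≡∣j-i∣ (m s) (y s + 1ℤ)) ⟩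
    suc ∣ y s + 1ℤ - m s ∣    ∎

argmax-such-that : ∀ {n} {P : Fin n → Set} → Decidable P → (f : Fin n → ℤ) → ∃ P →
  ∃ λ t → P t × (∀ u → P u → f u ≤ f t)
argmax-such-that {n} P? f (t₀ , Pt₀) =
  argmax f t₀ candidates , argmax-all f Pt₀ (all-filter P? (allFin n)) ,
  λ u Pu → v≤f[argmax]⁺ t₀ candidates (inj₂ (lose (∈-filter⁺ P? (∈-allFin u) Pu) ℤP.≤-refl))
  where candidates = filter P? (allFin n)

-- Sums over subsets

Σℤ-tabulate-+ : ∀ {n} (f g : Fin n → ℤ) →
  Σℤ (tabulate (λ u → f u + g u)) ≡ Σℤ (tabulate f) + Σℤ (tabulate g)
Σℤ-tabulate-+ {zero}  f g = refl
Σℤ-tabulate-+ {suc n} f g =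
  trans (cong (f Fin.zero + g Fin.zero +_) (Σℤ-tabulate-+ (f ∘ Fin.suc) (g ∘ Fin.suc)))
        (lemma (f Fin.zero) (g Fin.zero) _ _)
  where lemma : ∀ a b c d → a + b + (c + d) ≡ a + c + (b + d)
        lemma = solve-∀

Σℤ-tabulate-mono-≤ : ∀ {n} {f g : Fin n → ℤ} → (∀ u → f u ≤ g u) →
  Σℤ (tabulate f) ≤ Σℤ (tabulate g)
Σℤ-tabulate-mono-≤ {zero}  f≤g = ℤP.≤-refl
Σℤ-tabulate-mono-≤ {suc n} f≤g = ℤP.+-mono-≤ (f≤g Fin.zero) (Σℤ-tabulate-mono-≤ (f≤g ∘ Fin.suc))

Σℤ-tabulate-mono-< : ∀ {n} {f g : Fin n → ℤ} → (∀ u → f u ≤ g u) → ∀ s → f s < g s →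
  Σℤ (tabulate f) < Σℤ (tabulate g)
Σℤ-tabulate-mono-< {suc n} f≤g Fin.zero    fs<gs =
  ℤP.+-mono-<-≤ fs<gs (Σℤ-tabulate-mono-≤ (f≤g ∘ Fin.suc))
Σℤ-tabulate-mono-< {suc n} f≤g (Fin.suc s) fs<gs =
  ℤP.+-mono-≤-< (f≤g Fin.zero) (Σℤ-tabulate-mono-< (f≤g ∘ Fin.suc) s fs<gs)

mask : Bool → ℤ → ℤ
mask b z = if b then z else 0ℤ

mask-+ : ∀ b z w → mask b (z + w) ≡ mask b z + mask b w
mask-+ true  z w = refl
mask-+ false z w = refl

mask-minus : ∀ b z w → mask b (z - w) ≡ mask b z - mask b w
mask-minus true  z w = refl
mask-minus false z w = refl

does-∈? : ∀ {n} (u : Fin n) (Z : Subset n) → does (u ∈? Z) ≡ Vec.lookup Z u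
does-∈? Fin.zero    (true Vec.∷ Z)  = refl
does-∈? Fin.zero    (false Vec.∷ Z) = refl
does-∈? (Fin.suc u) (_ Vec.∷ Z)     = does-∈? u Z

x̃-tabulate : ∀ {n} (x : Fin n → ℤ) Z → x̃ x Z ≡ Σℤ (tabulate (λ u → mask (Vec.lookup Z u) (x u)))
x̃-tabulate x Z = cong Σℤ (trans (ListP.map-tabulate id _)
                                (ListP.tabulate-cong (λ u → cong (λ b → mask b (x u)) (does-∈? u Z))))

x̃-modular : ∀ {n} (x : Fin n → ℤ) X Y → x̃ x (X ∩ Y) + x̃ x (X ∪ Y) ≡ x̃ x X + x̃ x Y
x̃-modular x X Y = begin
  x̃ x (X ∩ Y) + x̃ x (X ∪ Y)
    ≡⟨ cong₂ _+_ (x̃-tabulate x (X ∩ Y)) (x̃-tabulate x (X ∪ Y)) ⟩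
  Σℤ (tabulate (on (X ∩ Y))) + Σℤ (tabulate (on (X ∪ Y)))
    ≡⟨ Σℤ-tabulate-+ (on (X ∩ Y)) (on (X ∪ Y)) ⟨
  Σℤ (tabulate (λ u → on (X ∩ Y) u + on (X ∪ Y) u))
    ≡⟨ cong Σℤ (ListP.tabulate-cong pointwise) ⟩
  Σℤ (tabulate (λ u → on X u + on Y u))
    ≡⟨ Σℤ-tabulate-+ (on X) (on Y) ⟩
  Σℤ (tabulate (on X)) + Σℤ (tabulate (on Y))
    ≡⟨ cong₂ _+_ (x̃-tabulate x X) (x̃-tabulate x Y) ⟨
  x̃ x X + x̃ x Y ∎
  where
  open ≡-Reasoning
  on : Subset _ → Fin _ → ℤ
  on Z u = mask (Vec.lookup Z u) (x u)
  mask-modular : ∀ b c z → mask (b ∧ c) z + mask (b ∨ c) z ≡ mask b z + mask c z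
  mask-modular true  true  z = refl
  mask-modular true  false z = trans (ℤP.+-identityˡ z) (sym (ℤP.+-identityʳ z))
  mask-modular false true  z = refl
  mask-modular false false z = refl
  pointwise : ∀ u → on (X ∩ Y) u + on (X ∪ Y) u ≡ on X u + on Y u
  pointwise u rewrite VecP.lookup-zipWith _∧_ u X Y | VecP.lookup-zipWith _∨_ u X Y =
    mask-modular (Vec.lookup X u) (Vec.lookup Y u) (x u)

x̃-mono-< : ∀ {n} {f g : Fin n → ℤ} {Z} → (∀ u → u ∈ Z → f u ≤ g u) →
  ∀ {s} → s ∈ Z → f s < g s → x̃ f Z < x̃ g Z
x̃-mono-< {f = f} {g} {Z} f≤g {s} s∈Z fs<gs =
  subst₂ _<_ (sym (x̃-tabulate f Z)) (sym (x̃-tabulate g Z)) (Σℤ-tabulate-mono-< masked-≤ s masked-<)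
  where
  masked-< : mask (Vec.lookup Z s) (f s) < mask (Vec.lookup Z s) (g s)
  masked-< rewrite VecP.[]=⇒lookup s∈Z = fs<gs
  masked-≤ : ∀ u → mask (Vec.lookup Z u) (f u) ≤ mask (Vec.lookup Z u) (g u)
  masked-≤ u with Vec.lookup Z u in u∈Z
  ... | true  = f≤g u (VecP.lookup⇒[]= u Z u∈Z)
  ... | false = ℤP.≤-refl

x̃-transfer : ∀ {n} {t s : Fin n} (x : Fin n → ℤ) Z → t ≢ s →
  x̃ (transfer t s x) Z ≡ x̃ x Z - mask (Vec.lookup Z t) 1ℤ + mask (Vec.lookup Z s) 1ℤ
x̃-transfer {t = t} {s} x Z t≢s with R , split ← tabulate-transfer t≢s
  with before , after ← split (λ u → mask (Vec.lookup Z u)) x = begin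
  x̃ (transfer t s x) Z
    ≡⟨ trans (x̃-tabulate _ Z) (Σℤ-↭ after) ⟩
  mask bt (x t - 1ℤ) + (mask bs (x s + 1ℤ) + rest)
    ≡⟨ cong₂ (λ u v → u + (v + rest)) (mask-minus bt (x t) 1ℤ) (mask-+ bs (x s) 1ℤ) ⟩
  (mask bt (x t) - mask bt 1ℤ) + (mask bs (x s) + mask bs 1ℤ + rest)
    ≡⟨ regroup (mask bt (x t)) (mask bt 1ℤ) (mask bs (x s)) (mask bs 1ℤ) rest ⟩
  mask bt (x t) + (mask bs (x s) + rest) - mask bt 1ℤ + mask bs 1ℤ
    ≡⟨ cong (λ v → v - mask bt 1ℤ + mask bs 1ℤ) (trans (x̃-tabulate _ Z) (Σℤ-↭ before)) ⟨
  x̃ x Z - mask bt 1ℤ + mask bs 1ℤ ∎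
  where
  open ≡-Reasoning
  bt = Vec.lookup Z t
  bs = Vec.lookup Z s
  rest = Σℤ (map (λ u → mask (Vec.lookup Z u) (x u)) R)
  regroup : ∀ a a′ b b′ r → a - a′ + (b + b′ + r) ≡ a + (b + r) - a′ + b′
  regroup = solve-∀

module BasePolyhedron {n} {p : SetFn n} (basePoly : IsBasePolyFn p) where

  open IsBasePolyFn basePoly

  Tight : (Fin n → ℤ) → Subset n → Set
  Tight x Z = p Z ≡ just (x̃ x Z)

  inBase-lowerBound : ∀ {x} → InBase p x → ∀ {Z v} → p Z ≡ just v → v ≤ x̃ x Z
  inBase-lowerBound (pS≡xS , lower) {Z} pZ≡v with any? (λ u → ¬? (u ∈? Z))
  ... | yes (u , u∉Z) = lower Z (⊆⊤ , u , ∈⊤ , u∉Z) _ pZ≡v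
  ... | no ∄u∉Z with refl ← ⊆-antisym ⊆⊤ (λ {u} _ → decidable-stable (u ∈? Z) (∄u∉Z ∘ (u ,_))) =
    ℤP.≤-reflexive (MaybeP.just-injective (trans (sym pZ≡v) pS≡xS))

  tight-∩ : ∀ {x X Y} → InBase p x → Tight x X → Tight x Y → Tight x (X ∩ Y)
  tight-∩ {x} {X} {Y} x∈B tX tY
    with c , d , p∩≡c , p∪≡d , sum≤ ← p-supermodular X Y _ _ tX tY =
    trans p∩≡c (cong just (ℤP.≤-antisym c≤ ≥c))
    where
    c≤ : c ≤ x̃ x (X ∩ Y)
    c≤ = inBase-lowerBound x∈B p∩≡c
    ≥c : x̃ x (X ∩ Y) ≤ c
    ≥c = +-cancelʳ-≤ (x̃ x (X ∪ Y)) (begin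
      x̃ x (X ∩ Y) + x̃ x (X ∪ Y)  ≡⟨ x̃-modular x X Y ⟩
      x̃ x X + x̃ x Y              ≤⟨ sum≤ ⟩
      c + d                      ≤⟨ ℤP.+-monoʳ-≤ c (inBase-lowerBound x∈B p∪≡d) ⟩
      c + x̃ x (X ∪ Y)            ∎)
      where open ℤP.≤-Reasoning

  tight-no-deficit : ∀ {x y Z} → Tight x Z → InBase p y → (∀ v → v ∈ Z → y v ≤ x v) →
    ∀ {s} → s ∈ Z → ¬ y s < x s
  tight-no-deficit {x} {y} {Z} tight y∈B y≤x s∈Z ys<xs =
    ℤP.<-irrefl refl (ℤP.<-≤-trans (x̃-mono-< y≤x s∈Z ys<xs) (inBase-lowerBound y∈B tight))

  Blocking : (Fin n → ℤ) → Fin n → Fin n → Subset n → Set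
  Blocking x t s Z = Tight x Z × t ∈ Z × s ∉ Z

  blocking? : ∀ x t s → Dec (∃ (Blocking x t s))
  blocking? x t s = anySubset? λ Z →
    MaybeP.≡-dec ℤP._≟_ (p Z) (just (x̃ x Z)) ×-dec (t ∈? Z) ×-dec ¬? (s ∈? Z)

  transfer-inBase : ∀ {x t s} → InBase p x → t ≢ s → ¬ ∃ (Blocking x t s) →
    InBase p (transfer t s x)
  transfer-inBase {x} {t} {s} x∈B@(pS≡xS , _) t≢s unblocked = top , lower
    where
    top : p ⊤ ≡ just (x̃ (transfer t s x) ⊤)
    top = trans pS≡xS (cong just (sym (begin
      x̃ (transfer t s x) ⊤
        ≡⟨ x̃-transfer x ⊤ t≢s ⟩
      x̃ x ⊤ - mask (Vec.lookup ⊤ t) 1ℤ + mask (Vec.lookup ⊤ s) 1ℤ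
        ≡⟨ cong₂ (λ a b → x̃ x ⊤ - mask a 1ℤ + mask b 1ℤ)
                 (VecP.lookup-replicate t true) (VecP.lookup-replicate s true) ⟩
      x̃ x ⊤ - 1ℤ + 1ℤ
        ≡⟨ i-1+1≡i _ ⟩
      x̃ x ⊤ ∎)))
      where open ≡-Reasoning
    lower : ∀ Z → Z ⊂ ⊤ → ∀ v → p Z ≡ just v → v ≤ x̃ (transfer t s x) Z
    lower Z _ v pZ≡v rewrite x̃-transfer x Z t≢s
      with inBase-lowerBound x∈B pZ≡v | Vec.lookup Z t in t?∈Z | Vec.lookup Z s in s?∈Z
    ... | v≤ | false | false = subst (v ≤_) (sym (trans (ℤP.+-identityʳ _) (ℤP.+-identityʳ _))) v≤
    ... | v≤ | false | true  = ℤP.≤-trans v≤ (subst (_≤ x̃ x Z - 0ℤ + 1ℤ) (ℤP.+-identityʳ _) (ℤP.i≤i+j _ 1ℤ))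
    ... | v≤ | true  | true  = subst (v ≤_) (sym (i-1+1≡i _)) v≤
    ... | v≤ | true  | false = subst (v ≤_) (sym (ℤP.+-identityʳ _)) (i<j⇒i≤j-1 (ℤP.≤∧≢⇒< v≤ v≢))
      where
      s∉Z : s ∉ Z
      s∉Z s∈Z = contradiction (trans (sym (VecP.[]=⇒lookup s∈Z)) s?∈Z) λ ()
      v≢ : v ≢ x̃ x Z
      v≢ refl = unblocked (Z , pZ≡v , VecP.lookup⇒[]= t Z t?∈Z , s∉Z)

  tight-separator : ∀ {x t} {P : Fin n → Set} → InBase p x → Decidable P →
    (∀ u → P u → ∃ (Blocking x t u)) → ∃ λ Z → Tight x Z × t ∈ Z × (∀ u → P u → u ∉ Z)
  tight-separator {x} {t} {P} x∈B P? blocked =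
    let Z , tight , t∈Z , sep = separate (allFin n) in Z , tight , t∈Z , λ u → sep (∈-allFin u)
    where
    separate : ∀ us → ∃ λ Z → Tight x Z × t ∈ Z × (∀ {u} → u ∈ₗ us → P u → u ∉ Z)
    separate [] = ⊤ , proj₁ x∈B , ∈⊤ , λ ()
    separate (w ∷ us) with separate us | P? w
    ... | Z , tZ , t∈Z , sep | no ¬Pw =
      Z , tZ , t∈Z , λ { (here refl) Pw → ⊥-elim (¬Pw Pw) ; (there u∈) → sep u∈ }
    ... | Z , tZ , t∈Z , sep | yes Pw with W , tW , t∈W , w∉W ← blocked w Pw =
      W ∩ Z , tight-∩ x∈B tW tZ , x∈p∩q⁺ (t∈W , t∈Z) ,
      λ { (here refl) _   → w∉W ∘ proj₁ ∘ x∈p∩q⁻ W Z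
        ; (there u∈)  Pu  → sep u∈ Pu ∘ proj₂ ∘ x∈p∩q⁻ W Z }

  base-exchange : ∀ {x y t} → InBase p x → InBase p y → x t < y t →
    ∃ λ s → y s < x s × InBase p (transfer t s y)
  base-exchange {x} {y} {t} x∈B y∈B xt<yt
    with any? (λ s → (y s ℤP.<? x s) ×-dec ¬? (blocking? y t s))
  ... | yes (s , ys<xs , unblocked) =
    s , ys<xs , transfer-inBase y∈B (λ { refl → ℤP.<-asym xt<yt ys<xs }) unblocked
  -- If every deficit of y were blocked, the blocking sets would intersect to a y-tight set
  -- containing t on which x ≤ y.
  ... | no none
    with Z , tight , t∈Z , sep ← tight-separator y∈B (λ s → y s ℤP.<? x s)
           (λ s ys<xs → decidable-stable (blocking? y t s) (λ unblocked → none (s , ys<xs , unblocked)))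
    = ⊥-elim (tight-no-deficit tight x∈B (λ v v∈Z → ℤP.≮⇒≥ (λ yv<xv → sep v yv<xv v∈Z)) t∈Z xt<yt)

module DecreasinglyMinimal {n} {p : SetFn n} (basePoly : IsBasePolyFn p)
                           {m} (m-decMin : DecMin p m) where

  open BasePolyhedron basePoly

  m∈B : InBase p m
  m∈B = proj₁ m-decMin

  -- A transfer across a gap of at least two lowers no prefix sum of the sorted vector and
  -- strictly lowers the sum of squares, so m would not be decreasingly minimal.
  steep-transfer-infeasible : ∀ {s u} → m u + 1ℤ < m s → ¬ InBase p (transfer s u m)
  steep-transfer-infeasible {s} {u} mu+1<ms m′∈B with proj₂ m-decMin (transfer s u m) m′∈B
  ... | inj₁ m↓≡m′↓ =
    ℤP.<-irrefl (sym (sumOfSquares-↓ m↓≡m′↓)) (sumOfSquares-transfer m mu+1<ms)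
  ... | inj₂ (j , jm , jm′ , agree , lt) =
    ℤP.<⇒≱ (prefixSum-<-lex j (m ↓) (transfer s u m ↓) jm jm′ agree lt)
           (topSum-transfer m (i+1<j⇒i<j mu+1<ms) (suc j))

  steep-transfer-blocked : ∀ {s u} → m u + 1ℤ < m s → ∃ (Blocking m s u)
  steep-transfer-blocked {s} {u} mu+1<ms = decidable-stable (blocking? m s u) λ unblocked →
    steep-transfer-infeasible mu+1<ms
      (transfer-inBase m∈B (distinct-by-< {x = m} (i+1<j⇒i<j mu+1<ms)) unblocked)

  deficit-below-peak : ∀ {y t s} → InBase p y → (∀ u → m u < y u → y u ≤ y t) →
    y s < m s → y s < y t
  deficit-below-peak {y} {t} {s} y∈B peak ys<ms with y s ℤP.<? y t
  ... | yes ys<yt = ys<yt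
  ... | no ys≮yt
    with Z , tight , s∈Z , sep ←
      tight-separator m∈B (λ u → m u + 1ℤ ℤP.<? m s) (λ _ → steep-transfer-blocked)
    = ⊥-elim (tight-no-deficit tight y∈B y≤m s∈Z ys<ms)
    where
    steep : ∀ {v} → m v < y v → m v + 1ℤ < m s
    steep {v} mv<yv = begin-strict
      m v + 1ℤ  ≤⟨ i<j⇒i+1≤j mv<yv ⟩
      y v       ≤⟨ peak v mv<yv ⟩
      y t       ≤⟨ ℤP.≮⇒≥ ys≮yt ⟩
      y s       <⟨ ys<ms ⟩
      m s       ∎
      where open ℤP.≤-Reasoning
    y≤m : ∀ v → v ∈ Z → y v ≤ m v
    y≤m v v∈Z = ℤP.≮⇒≥ λ mv<yv → sep v (steep mv<yv) v∈Z

  equal-if-no-excess : ∀ {y} → InBase p y → (∀ u → ¬ m u < y u) → ∀ u → m u ≡ y u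
  equal-if-no-excess {y} y∈B no-excess u =
    ℤP.≤-antisym (ℤP.≮⇒≥ no-deficit) (ℤP.≮⇒≥ (no-excess u))
    where
    no-deficit : ¬ y u < m u
    no-deficit yu<mu with s , ms<ys , _ ← base-exchange y∈B m∈B yu<mu = no-excess s ms<ys

  topSum-minimal-within : ∀ k N y → InBase p y → distance m y ℕ.< N → topSum k m ≤ topSum k y
  topSum-minimal-within k zero    y _   ()
  topSum-minimal-within k (suc N) y y∈B d<N with any? (λ u → m u ℤP.<? y u)
  ... | no ∄excess =
    ℤP.≤-reflexive (cong (prefixSum k) (↓-cong (equal-if-no-excess y∈B (λ u e → ∄excess (u , e)))))
  ... | yes excess
    with t , mt<yt , peak ← argmax-such-that (λ u → m u ℤP.<? y u) y excess
    with s , ys<ms , y′∈B ← base-exchange m∈B y∈B mt<yt =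
    ℤP.≤-trans (topSum-minimal-within k N (transfer t s y) y′∈B
                  (ℕP.<-≤-trans (distance-transfer m y mt<yt ys<ms) (ℕP.≤-pred d<N)))
               (topSum-transfer y (deficit-below-peak y∈B peak ys<ms) k)

  topSum-minimal : ∀ k y → InBase p y → topSum k m ≤ topSum k y
  topSum-minimal k y y∈B = topSum-minimal-within k (suc (distance m y)) y y∈B (ℕP.n<1+n _)

theorem3p7 : (n : ℕ) → 1 ℕ.≤ n → (p : SetFn n) → IsBasePolyFn p →
    (k : ℕ) → 1 ℕ.≤ k → k ℕ.≤ n →
    (m : Fin n → ℤ) → DecMin p m →
    (y : Fin n → ℤ) → InBase p y → topSum k m ℤ.≤ topSum k y
theorem3p7 n _ p basePoly k _ _ m m-decMin = DecreasinglyMinimal.topSum-minimal basePoly m-decMin k
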